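{- Let $q\ge 1$. For all integers $i,k\ge 0$, $v_{k2^q+i}\equiv v_i\pmod{2^q}$.
   Context: For an integer $n\ge 1$ let $v_n=\Big[(1-x)\prod_{j=0}^{2n-3}(2n-3-j+jx)\Big]_{x^{n-1}}$, where $[f(x)]_{x^m}$ denotes the coefficient of $x^m$ in $f$ (an empty product equals $1$, so $v_1=1$), and set $v_0=-1$. -}

module Defs where

open import Data.Nat as ℕ using (ℕ; zero; suc; _∸_)
open import Data.Integer using (ℤ; +_; -[1+_]; _+_; _*_; -_)
open import Data.List using (List; []; _∷_; map; upTo; foldr; lookup)

-- Polynomials with integer coefficients as coefficient lists
-- (index i = coefficient of x^i).
Poly : Set
Poly = List ℤ

_⊕_ : Poly → Poly → Poly
[] ⊕ q = q
(a ∷ p) ⊕ [] = a ∷ p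
(a ∷ p) ⊕ (b ∷ q) = (a + b) ∷ (p ⊕ q)

_·_ : ℤ → Poly → Poly
c · p = map (c *_) p

_⊗_ : Poly → Poly → Poly
[] ⊗ q = []
(a ∷ p) ⊗ q = (a · q) ⊕ (+ 0 ∷ (p ⊗ q))

one : Poly
one = + 1 ∷ []

coeff : Poly → ℕ → ℤ
coeff [] m = + 0
coeff (a ∷ p) zero = a
coeff (a ∷ p) (suc m) = coeff p m

prodFactors : ℕ → Poly
prodFactors m = foldr (λ j acc → (+ (m ∸ j) ∷ + j ∷ []) ⊗ acc) one (upTo (suc m))

-- ∏_{j=0}^{2n-3} (2n-3-j + j x) ; empty product (= 1) when 2n-3 < 0, i.e. n ≤ 1
P : ℕ → Poly
P zero = one
P (suc zero) = one
P (suc (suc k)) = prodFactors (suc (2 ℕ.* k))   -- 2(k+2) - 3 = 2k + 1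

oneMinusX : Poly
oneMinusX = + 1 ∷ -[1+ 0 ] ∷ []

v : ℕ → ℤ
v zero = -[1+ 0 ]
v (suc n) = coeff (oneMinusX ⊗ P (suc n)) n

{-# OPTIONS --safe #-}
module Submission where

-- v (n + 1) is the coefficient of x^n in (1 − x) P (n + 1), where P (n + 1) = ∏_{i<2n} ((2n − 1 − i) + i x)
-- is a product of consecutive factors (u − i) + (w + i) x.  For N = 2^q, q ≥ 1, and u + w odd, the
-- product of 2N such factors is ≡ x^N mod N: its two halves agree mod N, so it is ≡ the square of a
-- product of N factors, and squaring doubles the modulus (A ≡ C mod 2k ⇒ A² ≡ C² mod 4k); the base case
-- is (u + w x)((u − 1) + (w + 1) x) ≡ x mod 2.
-- The last 2N factors of P (N + n + 1) are such a product and its first 2n factors are ≡ those of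
-- P (n + 1), so P (N + n + 1) ≡ x^N P (n + 1) and v (N + n + 1) ≡ v (n + 1).  Completing P N by two more
-- factors, ≡ (1 + 2x)(2 + x) mod N, gives such a product again; solving (1 + 2x)(2 + x) P N ≡ x^N for
-- the coefficients of (1 − x) P N yields v N ≡ 4^N − 1 ≡ −1 = v 0.

open import Defs
open import Data.Nat as ℕ using (ℕ; _≥_; _^_)
open import Data.Integer using (+_; _-_)
open import Data.Integer.Divisibility using (_∣_)

open import Level using (0ℓ)
open import Function using (id)
open import Data.Nat using (zero; suc; _∸_; _≤_; _<_; z≤n; s≤s)
import Data.Nat.Properties as ℕP
import Data.Nat.Divisibility as ℕD
import Data.Nat.Tactic.RingSolver as ℕ-Solver
open import Data.Integer as ℤ using (ℤ; -_; _+_; _*_)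
import Data.Integer.Properties as ℤP
import Data.Integer.Divisibility.Signed as Signed
open import Data.Integer.DivMod using (_%ℕ_; _/ℕ_; n%ℕd<d; a≡a%ℕn+[a/ℕn]*n)
open import Data.Integer.Tactic.RingSolver using (solve-∀)
open import Data.List using ([]; _∷_; length; foldr; applyUpTo)
open import Relation.Binary.Bundles using (Setoid)
open import Relation.Binary.PropositionalEquality
import Relation.Binary.Reasoning.Setoid as SetoidReasoning

-- Congruences of integers

infix 4 _≡_mod_

record _≡_mod_ (a b : ℤ) (m : ℕ) : Set where
  constructor mod-by
  field difference-divisible : + m Signed.∣ a - b
open _≡_mod_ public

mod-by-multiple : ∀ {m a b} c → a - b ≡ c * + m → a ≡ b mod m
mod-by-multiple c eq = mod-by (Signed.divides c eq)

mod-by-identity : ∀ {m a b x} → a - b ≡ x → + m Signed.∣ x → a ≡ b mod m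
mod-by-identity {m} eq d = mod-by (subst (+ m Signed.∣_) (sym eq) d)

mod-reflexive : ∀ {m a b} → a ≡ b → a ≡ b mod m
mod-reflexive {a = a} refl = mod-by-multiple (+ 0) (ℤP.+-inverseʳ a)

mod-refl : ∀ {m a} → a ≡ a mod m
mod-refl = mod-reflexive refl

mod-sym : ∀ {m a b} → a ≡ b mod m → b ≡ a mod m
mod-sym {a = a} {b} (mod-by d) = mod-by-identity (negate a b) (Signed.∣m⇒∣-m d)
  where
  negate : ∀ a b → b - a ≡ - (a - b)
  negate = solve-∀

mod-trans : ∀ {m a b c} → a ≡ b mod m → b ≡ c mod m → a ≡ c mod m
mod-trans {a = a} {b} {c} (mod-by d) (mod-by e) =
  mod-by-identity (sym (ℤP.+-minus-telescope a b c)) (Signed.∣m∣n⇒∣m+n d e)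

+-cong-mod : ∀ {m a b c d} → a ≡ b mod m → c ≡ d mod m → a + c ≡ b + d mod m
+-cong-mod {a = a} {b} {c} {d} (mod-by e) (mod-by f) =
  mod-by-identity (regroup a b c d) (Signed.∣m∣n⇒∣m+n e f)
  where
  regroup : ∀ a b c d → (a + c) - (b + d) ≡ (a - b) + (c - d)
  regroup = solve-∀

*-cong-mod : ∀ {m a b c d} → a ≡ b mod m → c ≡ d mod m → a * c ≡ b * d mod m
*-cong-mod {a = a} {b} {c} {d} (mod-by e) (mod-by f) =
  mod-by-identity (regroup a b c d) (Signed.∣m∣n⇒∣m+n (Signed.∣n⇒∣m*n a f) (Signed.∣m⇒∣m*n d e))
  where
  regroup : ∀ a b c d → a * c - b * d ≡ a * (c - d) + (a - b) * d
  regroup = solve-∀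

-‿cong-mod : ∀ {m a b} → a ≡ b mod m → - a ≡ - b mod m
-‿cong-mod {a = a} {b} (mod-by d) = mod-by-identity (negate a b) (Signed.∣m⇒∣-m d)
  where
  negate : ∀ a b → - a - - b ≡ - (a - b)
  negate = solve-∀

+-congʳ-mod : ∀ {m a b} c → a ≡ b mod m → a + c ≡ b + c mod m
+-congʳ-mod c e = +-cong-mod e (mod-refl {a = c})

*-congˡ-mod : ∀ {m a b} c → a ≡ b mod m → c * a ≡ c * b mod m
*-congˡ-mod c = *-cong-mod (mod-refl {a = c})

*-zero-mod : ∀ {m k a b} → a ≡ + 0 mod m → b ≡ + 0 mod k → a * b ≡ + 0 mod m ℕ.* k
*-zero-mod {m} {k} {a} {b} (mod-by (Signed.divides c a≡)) (mod-by (Signed.divides d b≡)) =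
  mod-by-multiple (c * d) (begin
    a * b - + 0                   ≡⟨ ℤP.+-identityʳ (a * b) ⟩
    a * b                         ≡⟨ cong₂ _*_ (drop-zero a a≡) (drop-zero b b≡) ⟩
    (c * + m) * (d * + k)         ≡⟨ regroup c d (+ m) (+ k) ⟩
    (c * d) * (+ m * + k)         ≡⟨ cong ((c * d) *_) (ℤP.pos-* m k) ⟨
    (c * d) * + (m ℕ.* k)         ∎)
  where
  open ≡-Reasoning
  drop-zero : ∀ x {y} → x - + 0 ≡ y → x ≡ y
  drop-zero x eq = trans (sym (ℤP.+-identityʳ x)) eq
  regroup : ∀ c d m k → (c * m) * (d * k) ≡ (c * d) * (m * k)
  regroup = solve-∀

mod-weaken : ∀ {m k a b} → a ≡ b mod m ℕ.* k → a ≡ b mod m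
mod-weaken {m} {k} (mod-by d) =
  mod-by (Signed.∣-trans (Signed.divides (+ k) (trans (ℤP.pos-* m k) (ℤP.*-comm (+ m) (+ k)))) d)

mod-0⇒≡ : ∀ {a b} → a ≡ b mod 0 → a ≡ b
mod-0⇒≡ (mod-by d) = ℤP.i-j≡0⇒i≡j _ _ (Signed.0∣⇒≡0 d)

ℤ-mod-setoid : ℕ → Setoid 0ℓ 0ℓ
ℤ-mod-setoid m = record
  { Carrier = ℤ
  ; _≈_ = λ a b → a ≡ b mod m
  ; isEquivalence = record { refl = mod-refl ; sym = mod-sym ; trans = mod-trans }
  }

module ℤ-mod-Reasoning (m : ℕ) = SetoidReasoning (ℤ-mod-setoid m)

consecutive-even : ∀ a → a * (a + + 1) ≡ + 0 mod 2
consecutive-even a = subst Even (sym (a≡a%ℕn+[a/ℕn]*n a 2)) (by-remainder (a %ℕ 2) (n%ℕd<d a 2))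
  where
  Even : ℤ → Set
  Even x = x * (x + + 1) ≡ + 0 mod 2
  s : ℤ
  s = a /ℕ 2
  by-remainder : ∀ r → r < 2 → Even (+ r + s * + 2)
  by-remainder 0 _ = mod-by-multiple (s * (s * + 2 + + 1)) (even-case s)
    where
    even-case : ∀ s → (+ 0 + s * + 2) * ((+ 0 + s * + 2) + + 1) - + 0 ≡ (s * (s * + 2 + + 1)) * + 2
    even-case = solve-∀
  by-remainder 1 _ = mod-by-multiple ((+ 1 + s * + 2) * (s + + 1)) (odd-case s)
    where
    odd-case : ∀ s → (+ 1 + s * + 2) * ((+ 1 + s * + 2) + + 1) - + 0 ≡ ((+ 1 + s * + 2) * (s + + 1)) * + 2
    odd-case = solve-∀
  by-remainder (suc (suc _)) (s≤s (s≤s ()))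

pos-∸ : ∀ {m i} → i ≤ m → + (m ∸ i) ≡ + m - + i
pos-∸ {m} {i} i≤m = sym (trans (ℤP.m-n≡m⊖n m i) (ℤP.⊖-≥ i≤m))

n<2^n : ∀ n → n < 2 ^ n
n<2^n zero = s≤s z≤n
n<2^n (suc n) = ℕP.+-mono-≤ (ℕP.≤-trans (s≤s z≤n) (n<2^n n)) (ℕP.m≤n⇒m≤n+o 0 (n<2^n n))

pos-^ : ∀ m n → + (m ^ n) ≡ (+ m) ℤ.^ n
pos-^ m zero = refl
pos-^ m (suc n) = trans (ℤP.pos-* m (m ^ n)) (cong (λ x → + m * x) (pos-^ m n))

2^q∣4^2^q : ∀ q → 2 ^ q ℕD.∣ 4 ^ (2 ^ q)
2^q∣4^2^q q = subst (2 ^ q ℕD.∣_) split (ℕD.m∣m*n (2 ^ (2 ℕ.* N ∸ q)))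
  where
  N : ℕ
  N = 2 ^ q
  q≤2N : q ≤ 2 ℕ.* N
  q≤2N = ℕP.≤-trans (ℕP.<⇒≤ (n<2^n q)) (ℕP.m≤m+n N (N ℕ.+ 0))
  split : 2 ^ q ℕ.* 2 ^ (2 ℕ.* N ∸ q) ≡ 4 ^ N
  split = sym (trans (ℕP.^-*-assoc 2 2 N)
                (trans (cong (2 ^_) (sym (ℕP.m+[n∸m]≡n q≤2N))) (ℕP.^-distribˡ-+-* 2 q (2 ℕ.* N ∸ q))))

4^2^q≡0 : ∀ q → (+ 4) ℤ.^ (2 ^ q) ≡ + 0 mod 2 ^ q
4^2^q≡0 q = mod-by (subst (+ (2 ^ q) Signed.∣_) (trans (pos-^ 4 (2 ^ q)) (sym (ℤP.+-identityʳ _)))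
                     (Signed.∣ᵤ⇒∣ {+ (2 ^ q)} {+ (4 ^ (2 ^ q))} (2^q∣4^2^q q)))

-- Polynomials up to coefficientwise equality and congruence

-- Coefficient lists may carry trailing zeros, so polynomials are compared coefficientwise.
infix 4 _≈_ _≈_mod_

record _≈_ (p q : Poly) : Set where
  constructor coeffwise
  field coeff-≡ : ∀ k → coeff p k ≡ coeff q k
open _≈_ public

record _≈_mod_ (p q : Poly) (m : ℕ) : Set where
  constructor coeffwise-mod
  field coeff-mod : ∀ k → coeff p k ≡ coeff q k mod m
open _≈_mod_ public

≈-reflexive : ∀ {p q} → p ≡ q → p ≈ q
≈-reflexive refl = coeffwise λ _ → refl

≈-refl : ∀ {p} → p ≈ p
≈-refl = ≈-reflexive refl

≈-sym : ∀ {p q} → p ≈ q → q ≈ p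
≈-sym e = coeffwise λ k → sym (coeff-≡ e k)

≈-trans : ∀ {p q r} → p ≈ q → q ≈ r → p ≈ r
≈-trans e f = coeffwise λ k → trans (coeff-≡ e k) (coeff-≡ f k)

≈-setoid : Setoid 0ℓ 0ℓ
≈-setoid = record
  { Carrier = Poly
  ; _≈_ = _≈_
  ; isEquivalence = record { refl = ≈-refl ; sym = ≈-sym ; trans = ≈-trans }
  }

module ≈-Reasoning = SetoidReasoning ≈-setoid

≈⇒≈-mod : ∀ {m p q} → p ≈ q → p ≈ q mod m
≈⇒≈-mod e = coeffwise-mod λ k → mod-reflexive (coeff-≡ e k)

≈-mod-0⇒≈ : ∀ {p q} → p ≈ q mod 0 → p ≈ q
≈-mod-0⇒≈ e = coeffwise λ k → mod-0⇒≡ (coeff-mod e k)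

≈-mod-weaken : ∀ {m k p q} → p ≈ q mod m ℕ.* k → p ≈ q mod m
≈-mod-weaken e = coeffwise-mod λ j → mod-weaken (coeff-mod e j)

≈-mod-refl : ∀ {m p} → p ≈ p mod m
≈-mod-refl = ≈⇒≈-mod ≈-refl

≈-mod-sym : ∀ {m p q} → p ≈ q mod m → q ≈ p mod m
≈-mod-sym e = coeffwise-mod λ k → mod-sym (coeff-mod e k)

≈-mod-trans : ∀ {m p q r} → p ≈ q mod m → q ≈ r mod m → p ≈ r mod m
≈-mod-trans e f = coeffwise-mod λ k → mod-trans (coeff-mod e k) (coeff-mod f k)

≈-mod-setoid : ℕ → Setoid 0ℓ 0ℓ
≈-mod-setoid m = record
  { Carrier = Poly
  ; _≈_ = λ p q → p ≈ q mod m
  ; isEquivalence = record { refl = ≈-mod-refl ; sym = ≈-mod-sym ; trans = ≈-mod-trans }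
  }

module ≈-mod-Reasoning (m : ℕ) = SetoidReasoning (≈-mod-setoid m)

coeff-⊕ : ∀ p q k → coeff (p ⊕ q) k ≡ coeff p k + coeff q k
coeff-⊕ [] q k = sym (ℤP.+-identityˡ (coeff q k))
coeff-⊕ (a ∷ p) [] k = sym (ℤP.+-identityʳ (coeff (a ∷ p) k))
coeff-⊕ (a ∷ p) (b ∷ q) zero = refl
coeff-⊕ (a ∷ p) (b ∷ q) (suc k) = coeff-⊕ p q k

coeff-· : ∀ c p k → coeff (c · p) k ≡ c * coeff p k
coeff-· c [] k = sym (ℤP.*-zeroʳ c)
coeff-· c (a ∷ p) zero = refl
coeff-· c (a ∷ p) (suc k) = coeff-· c p k

coeff-beyond-length : ∀ p k → length p ≤ k → coeff p k ≡ + 0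
coeff-beyond-length [] k _ = refl
coeff-beyond-length (a ∷ p) (suc k) (s≤s le) = coeff-beyond-length p k le

∷-cong : ∀ {a b p q} → a ≡ b → p ≈ q → a ∷ p ≈ b ∷ q
∷-cong a≡b e = coeffwise λ { zero → a≡b ; (suc k) → coeff-≡ e k }

∷-cong-mod : ∀ {m a b p q} → a ≡ b mod m → p ≈ q mod m → a ∷ p ≈ b ∷ q mod m
∷-cong-mod a≡b e = coeffwise-mod λ { zero → a≡b ; (suc k) → coeff-mod e k }

⊕-cong : ∀ {p p′ q q′} → p ≈ p′ → q ≈ q′ → p ⊕ q ≈ p′ ⊕ q′
⊕-cong {p} {p′} {q} {q′} e f = coeffwise λ k →
  trans (coeff-⊕ p q k) (trans (cong₂ _+_ (coeff-≡ e k) (coeff-≡ f k)) (sym (coeff-⊕ p′ q′ k)))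

⊕-cong-mod : ∀ {m p p′ q q′} → p ≈ p′ mod m → q ≈ q′ mod m → p ⊕ q ≈ p′ ⊕ q′ mod m
⊕-cong-mod {m} {p} {p′} {q} {q′} e f = coeffwise-mod λ k → begin
  coeff (p ⊕ q) k          ≡⟨ coeff-⊕ p q k ⟩
  coeff p k + coeff q k    ≈⟨ +-cong-mod (coeff-mod e k) (coeff-mod f k) ⟩
  coeff p′ k + coeff q′ k  ≡⟨ coeff-⊕ p′ q′ k ⟨
  coeff (p′ ⊕ q′) k        ∎
  where open ℤ-mod-Reasoning m

·-cong-mod : ∀ {m p q} c → p ≈ q mod m → c · p ≈ c · q mod m
·-cong-mod {m} {p} {q} c e = coeffwise-mod λ k → begin
  coeff (c · p) k  ≡⟨ coeff-· c p k ⟩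
  c * coeff p k    ≈⟨ *-congˡ-mod c (coeff-mod e k) ⟩
  c * coeff q k    ≡⟨ coeff-· c q k ⟨
  coeff (c · q) k  ∎
  where open ℤ-mod-Reasoning m

⊕-identityʳ : ∀ p → p ⊕ [] ≡ p
⊕-identityʳ [] = refl
⊕-identityʳ (a ∷ p) = refl

⊕-comm : ∀ p q → p ⊕ q ≈ q ⊕ p
⊕-comm p q = coeffwise λ k →
  trans (coeff-⊕ p q k) (trans (ℤP.+-comm (coeff p k) (coeff q k)) (sym (coeff-⊕ q p k)))

⊕-assoc : ∀ p q r → (p ⊕ q) ⊕ r ≈ p ⊕ (q ⊕ r)
⊕-assoc p q r = coeffwise λ k → begin
  coeff ((p ⊕ q) ⊕ r) k                   ≡⟨ coeff-⊕ (p ⊕ q) r k ⟩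
  coeff (p ⊕ q) k + coeff r k             ≡⟨ cong (_+ coeff r k) (coeff-⊕ p q k) ⟩
  coeff p k + coeff q k + coeff r k       ≡⟨ ℤP.+-assoc (coeff p k) (coeff q k) (coeff r k) ⟩
  coeff p k + (coeff q k + coeff r k)     ≡⟨ cong (λ x → coeff p k + x) (coeff-⊕ q r k) ⟨
  coeff p k + coeff (q ⊕ r) k             ≡⟨ coeff-⊕ p (q ⊕ r) k ⟨
  coeff (p ⊕ (q ⊕ r)) k                   ∎
  where open ≡-Reasoning

⊕-left-comm : ∀ p q r → p ⊕ (q ⊕ r) ≈ q ⊕ (p ⊕ r)
⊕-left-comm p q r = begin
  p ⊕ (q ⊕ r)  ≈⟨ ⊕-assoc p q r ⟨
  (p ⊕ q) ⊕ r  ≈⟨ ⊕-cong (⊕-comm p q) ≈-refl ⟩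
  (q ⊕ p) ⊕ r  ≈⟨ ⊕-assoc q p r ⟩
  q ⊕ (p ⊕ r)  ∎
  where open ≈-Reasoning

⊕-interchange : ∀ p q r s → (p ⊕ q) ⊕ (r ⊕ s) ≈ (p ⊕ r) ⊕ (q ⊕ s)
⊕-interchange p q r s = begin
  (p ⊕ q) ⊕ (r ⊕ s)  ≈⟨ ⊕-assoc p q (r ⊕ s) ⟩
  p ⊕ (q ⊕ (r ⊕ s))  ≈⟨ ⊕-cong (≈-refl {p}) (⊕-left-comm q r s) ⟩
  p ⊕ (r ⊕ (q ⊕ s))  ≈⟨ ⊕-assoc p r (q ⊕ s) ⟨
  (p ⊕ r) ⊕ (q ⊕ s)  ∎
  where open ≈-Reasoning

·-assoc : ∀ a b p → (a * b) · p ≈ a · (b · p)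
·-assoc a b p = coeffwise λ k → begin
  coeff ((a * b) · p) k    ≡⟨ coeff-· (a * b) p k ⟩
  a * b * coeff p k        ≡⟨ ℤP.*-assoc a b (coeff p k) ⟩
  a * (b * coeff p k)      ≡⟨ cong (a *_) (coeff-· b p k) ⟨
  a * coeff (b · p) k      ≡⟨ coeff-· a (b · p) k ⟨
  coeff (a · (b · p)) k    ∎
  where open ≡-Reasoning

·-distribʳ-+ : ∀ a b p → (a + b) · p ≈ (a · p) ⊕ (b · p)
·-distribʳ-+ a b p = coeffwise λ k → begin
  coeff ((a + b) · p) k                ≡⟨ coeff-· (a + b) p k ⟩
  (a + b) * coeff p k                  ≡⟨ ℤP.*-distribʳ-+ (coeff p k) a b ⟩
  a * coeff p k + b * coeff p k        ≡⟨ cong₂ _+_ (coeff-· a p k) (coeff-· b p k) ⟨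
  coeff (a · p) k + coeff (b · p) k    ≡⟨ coeff-⊕ (a · p) (b · p) k ⟨
  coeff ((a · p) ⊕ (b · p)) k          ∎
  where open ≡-Reasoning

·-distribˡ-⊕ : ∀ c p q → c · (p ⊕ q) ≈ (c · p) ⊕ (c · q)
·-distribˡ-⊕ c p q = coeffwise λ k → begin
  coeff (c · (p ⊕ q)) k                ≡⟨ coeff-· c (p ⊕ q) k ⟩
  c * coeff (p ⊕ q) k                  ≡⟨ cong (c *_) (coeff-⊕ p q k) ⟩
  c * (coeff p k + coeff q k)          ≡⟨ ℤP.*-distribˡ-+ c (coeff p k) (coeff q k) ⟩
  c * coeff p k + c * coeff q k        ≡⟨ cong₂ _+_ (coeff-· c p k) (coeff-· c q k) ⟨
  coeff (c · p) k + coeff (c · q) k    ≡⟨ coeff-⊕ (c · p) (c · q) k ⟨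
  coeff ((c · p) ⊕ (c · q)) k          ∎
  where open ≡-Reasoning

·-identity : ∀ p → (+ 1) · p ≈ p
·-identity p = coeffwise λ k → trans (coeff-· (+ 1) p k) (ℤP.*-identityˡ (coeff p k))

0∷[]≈[] : + 0 ∷ [] ≈ []
0∷[]≈[] = coeffwise λ { zero → refl ; (suc k) → refl }

0∷-⊗ : ∀ p q → (+ 0 ∷ p) ⊗ q ≈ + 0 ∷ (p ⊗ q)
0∷-⊗ p q = coeffwise λ k →
  trans (coeff-⊕ ((+ 0) · q) (+ 0 ∷ (p ⊗ q)) k)
        (trans (cong (_+ coeff (+ 0 ∷ (p ⊗ q)) k) (coeff-· (+ 0) q k)) (ℤP.+-identityˡ _))

⊗-zeroʳ : ∀ p → p ⊗ [] ≈ []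
⊗-zeroʳ [] = ≈-refl
⊗-zeroʳ (a ∷ p) = ≈-trans (∷-cong refl (⊗-zeroʳ p)) 0∷[]≈[]

⊗-identityˡ : ∀ p → one ⊗ p ≈ p
⊗-identityˡ p = begin
  ((+ 1) · p) ⊕ (+ 0 ∷ [])  ≈⟨ ⊕-cong ≈-refl 0∷[]≈[] ⟩
  ((+ 1) · p) ⊕ []          ≡⟨ ⊕-identityʳ ((+ 1) · p) ⟩
  (+ 1) · p                 ≈⟨ ·-identity p ⟩
  p                         ∎
  where open ≈-Reasoning

⊗-∷ʳ : ∀ q a p → q ⊗ (a ∷ p) ≈ (a · q) ⊕ (+ 0 ∷ (q ⊗ p))
⊗-∷ʳ [] a p = ≈-sym 0∷[]≈[]
⊗-∷ʳ (b ∷ q) a p = ∷-cong (cong (_+ + 0) (ℤP.*-comm b a)) (begin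
  (b · p) ⊕ (q ⊗ (a ∷ p))                ≈⟨ ⊕-cong ≈-refl (⊗-∷ʳ q a p) ⟩
  (b · p) ⊕ ((a · q) ⊕ (+ 0 ∷ (q ⊗ p)))  ≈⟨ ⊕-left-comm (b · p) (a · q) (+ 0 ∷ (q ⊗ p)) ⟩
  (a · q) ⊕ ((b · p) ⊕ (+ 0 ∷ (q ⊗ p)))  ∎)
  where open ≈-Reasoning

⊗-comm : ∀ p q → p ⊗ q ≈ q ⊗ p
⊗-comm [] q = ≈-sym (⊗-zeroʳ q)
⊗-comm (a ∷ p) q = ≈-trans (⊕-cong ≈-refl (∷-cong refl (⊗-comm p q))) (≈-sym (⊗-∷ʳ q a p))

⊗-identityʳ : ∀ p → p ⊗ one ≈ p
⊗-identityʳ p = ≈-trans (⊗-comm p one) (⊗-identityˡ p)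

⊗-distribʳ-⊕ : ∀ p q r → (p ⊕ q) ⊗ r ≈ (p ⊗ r) ⊕ (q ⊗ r)
⊗-distribʳ-⊕ [] q r = ≈-refl
⊗-distribʳ-⊕ (a ∷ p) [] r = ≈-reflexive (sym (⊕-identityʳ ((a ∷ p) ⊗ r)))
⊗-distribʳ-⊕ (a ∷ p) (b ∷ q) r = begin
  ((a + b) · r) ⊕ (+ 0 ∷ ((p ⊕ q) ⊗ r))
    ≈⟨ ⊕-cong (·-distribʳ-+ a b r) (∷-cong refl (⊗-distribʳ-⊕ p q r)) ⟩
  ((a · r) ⊕ (b · r)) ⊕ ((+ 0 ∷ (p ⊗ r)) ⊕ (+ 0 ∷ (q ⊗ r)))
    ≈⟨ ⊕-interchange (a · r) (b · r) (+ 0 ∷ (p ⊗ r)) (+ 0 ∷ (q ⊗ r)) ⟩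
  ((a · r) ⊕ (+ 0 ∷ (p ⊗ r))) ⊕ ((b · r) ⊕ (+ 0 ∷ (q ⊗ r)))
    ∎
  where open ≈-Reasoning

·-⊗-assoc : ∀ c p q → (c · p) ⊗ q ≈ c · (p ⊗ q)
·-⊗-assoc c [] q = ≈-refl
·-⊗-assoc c (a ∷ p) q = begin
  ((c * a) · q) ⊕ (+ 0 ∷ ((c · p) ⊗ q))
    ≈⟨ ⊕-cong (·-assoc c a q) (∷-cong (sym (ℤP.*-zeroʳ c)) (·-⊗-assoc c p q)) ⟩
  (c · (a · q)) ⊕ (c · (+ 0 ∷ (p ⊗ q)))
    ≈⟨ ·-distribˡ-⊕ c (a · q) (+ 0 ∷ (p ⊗ q)) ⟨
  c · ((a · q) ⊕ (+ 0 ∷ (p ⊗ q)))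
    ∎
  where open ≈-Reasoning

⊗-assoc : ∀ p q r → (p ⊗ q) ⊗ r ≈ p ⊗ (q ⊗ r)
⊗-assoc [] q r = ≈-refl
⊗-assoc (a ∷ p) q r = begin
  ((a · q) ⊕ (+ 0 ∷ (p ⊗ q))) ⊗ r        ≈⟨ ⊗-distribʳ-⊕ (a · q) (+ 0 ∷ (p ⊗ q)) r ⟩
  ((a · q) ⊗ r) ⊕ ((+ 0 ∷ (p ⊗ q)) ⊗ r)  ≈⟨ ⊕-cong (·-⊗-assoc a q r) (0∷-⊗ (p ⊗ q) r) ⟩
  (a · (q ⊗ r)) ⊕ (+ 0 ∷ ((p ⊗ q) ⊗ r))  ≈⟨ ⊕-cong ≈-refl (∷-cong refl (⊗-assoc p q r)) ⟩
  (a · (q ⊗ r)) ⊕ (+ 0 ∷ (p ⊗ (q ⊗ r)))  ∎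
  where open ≈-Reasoning

⊗-congʳ-mod : ∀ {m q q′} p → q ≈ q′ mod m → p ⊗ q ≈ p ⊗ q′ mod m
⊗-congʳ-mod [] e = ≈-mod-refl
⊗-congʳ-mod (a ∷ p) e = ⊕-cong-mod (·-cong-mod a e) (∷-cong-mod mod-refl (⊗-congʳ-mod p e))

⊗-congˡ-mod : ∀ {m p p′} q → p ≈ p′ mod m → p ⊗ q ≈ p′ ⊗ q mod m
⊗-congˡ-mod {m} {p} {p′} q e = begin
  p ⊗ q   ≈⟨ ≈⇒≈-mod (⊗-comm p q) ⟩
  q ⊗ p   ≈⟨ ⊗-congʳ-mod q e ⟩
  q ⊗ p′  ≈⟨ ≈⇒≈-mod (⊗-comm q p′) ⟩
  p′ ⊗ q  ∎
  where open ≈-mod-Reasoning m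

⊗-cong-mod : ∀ {m p p′ q q′} → p ≈ p′ mod m → q ≈ q′ mod m → p ⊗ q ≈ p′ ⊗ q′ mod m
⊗-cong-mod {p′ = p′} {q = q} e f = ≈-mod-trans (⊗-congˡ-mod q e) (⊗-congʳ-mod p′ f)

⊗-cong : ∀ {p p′ q q′} → p ≈ p′ → q ≈ q′ → p ⊗ q ≈ p′ ⊗ q′
⊗-cong e f = ≈-mod-0⇒≈ (⊗-cong-mod (≈⇒≈-mod e) (≈⇒≈-mod f))

⊗-distribˡ-⊕ : ∀ p q r → p ⊗ (q ⊕ r) ≈ (p ⊗ q) ⊕ (p ⊗ r)
⊗-distribˡ-⊕ p q r = begin
  p ⊗ (q ⊕ r)        ≈⟨ ⊗-comm p (q ⊕ r) ⟩
  (q ⊕ r) ⊗ p        ≈⟨ ⊗-distribʳ-⊕ q r p ⟩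
  (q ⊗ p) ⊕ (r ⊗ p)  ≈⟨ ⊕-cong (⊗-comm q p) (⊗-comm r p) ⟩
  (p ⊗ q) ⊕ (p ⊗ r)  ∎
  where open ≈-Reasoning

square-expansion : ∀ p q → (p ⊕ q) ⊗ (p ⊕ q) ≈ (p ⊗ p) ⊕ (((+ 2) · (p ⊗ q)) ⊕ (q ⊗ q))
square-expansion p q = begin
  (p ⊕ q) ⊗ (p ⊕ q)                          ≈⟨ ⊗-distribʳ-⊕ p q (p ⊕ q) ⟩
  (p ⊗ (p ⊕ q)) ⊕ (q ⊗ (p ⊕ q))
    ≈⟨ ⊕-cong (⊗-distribˡ-⊕ p p q) (⊗-distribˡ-⊕ q p q) ⟩
  ((p ⊗ p) ⊕ (p ⊗ q)) ⊕ ((q ⊗ p) ⊕ (q ⊗ q))  ≈⟨ ⊕-assoc (p ⊗ p) (p ⊗ q) _ ⟩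
  (p ⊗ p) ⊕ ((p ⊗ q) ⊕ ((q ⊗ p) ⊕ (q ⊗ q)))
    ≈⟨ ⊕-cong (≈-refl {p ⊗ p}) (⊕-assoc (p ⊗ q) (q ⊗ p) (q ⊗ q)) ⟨
  (p ⊗ p) ⊕ (((p ⊗ q) ⊕ (q ⊗ p)) ⊕ (q ⊗ q))
    ≈⟨ ⊕-cong (≈-refl {p ⊗ p}) (⊕-cong doubled (≈-refl {q ⊗ q})) ⟩
  (p ⊗ p) ⊕ (((+ 2) · (p ⊗ q)) ⊕ (q ⊗ q))    ∎
  where
  open ≈-Reasoning
  doubled : (p ⊗ q) ⊕ (q ⊗ p) ≈ (+ 2) · (p ⊗ q)
  doubled = begin
    (p ⊗ q) ⊕ (q ⊗ p)                    ≈⟨ ⊕-cong (·-identity (p ⊗ q)) (⊗-comm p q) ⟨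
    ((+ 1) · (p ⊗ q)) ⊕ (p ⊗ q)          ≈⟨ ⊕-cong ≈-refl (·-identity (p ⊗ q)) ⟨
    ((+ 1) · (p ⊗ q)) ⊕ ((+ 1) · (p ⊗ q))  ≈⟨ ·-distribʳ-+ (+ 1) (+ 1) (p ⊗ q) ⟨
    (+ 2) · (p ⊗ q)                      ∎

⊗-zero-mod : ∀ {m k} p q → p ≈ [] mod m → q ≈ [] mod k → p ⊗ q ≈ [] mod m ℕ.* k
⊗-zero-mod [] q e f = ≈-mod-refl
⊗-zero-mod {m} {k} (a ∷ p) q e f = coeffwise-mod λ j → begin
  coeff ((a · q) ⊕ (+ 0 ∷ (p ⊗ q))) j        ≡⟨ coeff-⊕ (a · q) (+ 0 ∷ (p ⊗ q)) j ⟩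
  coeff (a · q) j + coeff (+ 0 ∷ (p ⊗ q)) j  ≡⟨ cong (_+ coeff (+ 0 ∷ (p ⊗ q)) j) (coeff-· a q j) ⟩
  a * coeff q j + coeff (+ 0 ∷ (p ⊗ q)) j
    ≈⟨ +-cong-mod (*-zero-mod (coeff-mod e 0) (coeff-mod f j)) (coeff-mod tail j) ⟩
  + 0                                        ∎
  where
  open ℤ-mod-Reasoning (m ℕ.* k)
  tail : + 0 ∷ (p ⊗ q) ≈ [] mod m ℕ.* k
  tail = ≈-mod-trans (∷-cong-mod mod-refl (⊗-zero-mod p q (coeffwise-mod λ j → coeff-mod e (suc j)) f))
                     (≈⇒≈-mod 0∷[]≈[])

·-zero-mod : ∀ {m p} c → p ≈ [] mod m → (+ c) · p ≈ [] mod c ℕ.* m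
·-zero-mod {m} {p} c e = coeffwise-mod λ k → begin
  coeff ((+ c) · p) k  ≡⟨ coeff-· (+ c) p k ⟩
  + c * coeff p k      ≈⟨ *-zero-mod c≡0 (coeff-mod e k) ⟩
  + 0                  ∎
  where
  open ℤ-mod-Reasoning (c ℕ.* m)
  c≡0 : + c ≡ + 0 mod c
  c≡0 = mod-by-multiple (+ 1) (trans (ℤP.+-identityʳ (+ c)) (sym (ℤP.*-identityˡ (+ c))))

⊕-difference : ∀ p q → p ≈ q ⊕ (p ⊕ ((- + 1) · q))
⊕-difference p q = coeffwise λ j → begin
  coeff p j                                        ≡⟨ split (coeff p j) (coeff q j) ⟩
  coeff q j + (coeff p j + (- + 1) * coeff q j)
    ≡⟨ cong (λ x → coeff q j + (coeff p j + x)) (coeff-· (- + 1) q j) ⟨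
  coeff q j + (coeff p j + coeff ((- + 1) · q) j)
    ≡⟨ cong (λ x → coeff q j + x) (coeff-⊕ p ((- + 1) · q) j) ⟨
  coeff q j + coeff (p ⊕ ((- + 1) · q)) j          ≡⟨ coeff-⊕ q (p ⊕ ((- + 1) · q)) j ⟨
  coeff (q ⊕ (p ⊕ ((- + 1) · q))) j                ∎
  where
  open ≡-Reasoning
  split : ∀ x y → x ≡ y + (x + (- + 1) * y)
  split = solve-∀

difference-mod : ∀ {m p q} → p ≈ q mod m → p ⊕ ((- + 1) · q) ≈ [] mod m
difference-mod {p = p} {q} p≈q = coeffwise-mod λ j →
  mod-by-identity (difference j) (difference-divisible (coeff-mod p≈q j))
  where
  difference : ∀ j → coeff (p ⊕ ((- + 1) · q)) j - + 0 ≡ coeff p j - coeff q j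
  difference j = trans (ℤP.+-identityʳ _) (trans (coeff-⊕ p ((- + 1) · q) j)
                   (cong (λ x → coeff p j + x) (trans (coeff-· (- + 1) q j) (ℤP.-1*i≡-i (coeff q j)))))

square-mod : ∀ {k p q} → p ≈ q mod 2 ℕ.* k → p ⊗ p ≈ q ⊗ q mod 2 ℕ.* (2 ℕ.* k)
square-mod {k} {p} {q} p≈q = begin
  p ⊗ p
    ≈⟨ ≈⇒≈-mod (⊗-cong (⊕-difference p q) (⊕-difference p q)) ⟩
  (q ⊕ e) ⊗ (q ⊕ e)                        ≈⟨ ≈⇒≈-mod (square-expansion q e) ⟩
  (q ⊗ q) ⊕ (((+ 2) · (q ⊗ e)) ⊕ (e ⊗ e))
    ≈⟨ ⊕-cong-mod ≈-mod-refl (⊕-cong-mod cross-term square-term) ⟩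
  (q ⊗ q) ⊕ []                             ≡⟨ ⊕-identityʳ (q ⊗ q) ⟩
  q ⊗ q                                    ∎
  where
  open ≈-mod-Reasoning (2 ℕ.* (2 ℕ.* k))
  e : Poly
  e = p ⊕ ((- + 1) · q)
  e≈0 : e ≈ [] mod 2 ℕ.* k
  e≈0 = difference-mod p≈q
  cross-term : (+ 2) · (q ⊗ e) ≈ [] mod 2 ℕ.* (2 ℕ.* k)
  cross-term = ·-zero-mod 2 (≈-mod-trans (⊗-congʳ-mod q e≈0) (≈⇒≈-mod (⊗-zeroʳ q)))
  square-term : e ⊗ e ≈ [] mod 2 ℕ.* (2 ℕ.* k)
  square-term = ≈-mod-weaken (subst (e ⊗ e ≈ [] mod_) (regroup k) (⊗-zero-mod e e e≈0 e≈0))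
    where
    regroup : ∀ k → (2 ℕ.* k) ℕ.* (2 ℕ.* k) ≡ (2 ℕ.* (2 ℕ.* k)) ℕ.* k
    regroup = ℕ-Solver.solve-∀

x^ : ℕ → Poly
x^ zero = one
x^ (suc n) = + 0 ∷ x^ n

x^-+ : ∀ a b → x^ (a ℕ.+ b) ≈ x^ a ⊗ x^ b
x^-+ zero b = ≈-sym (⊗-identityˡ (x^ b))
x^-+ (suc a) b = ≈-trans (∷-cong refl (x^-+ a b)) (≈-sym (0∷-⊗ (x^ a) (x^ b)))

coeff-x^-⊗-< : ∀ n p k → k < n → coeff (x^ n ⊗ p) k ≡ + 0
coeff-x^-⊗-< (suc n) p zero _ = coeff-≡ (0∷-⊗ (x^ n) p) zero
coeff-x^-⊗-< (suc n) p (suc k) (s≤s k<n) =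
  trans (coeff-≡ (0∷-⊗ (x^ n) p) (suc k)) (coeff-x^-⊗-< n p k k<n)

coeff-x^-⊗-≥ : ∀ n p k → n ≤ k → coeff (x^ n ⊗ p) k ≡ coeff p (k ∸ n)
coeff-x^-⊗-≥ zero p k _ = coeff-≡ (⊗-identityˡ p) k
coeff-x^-⊗-≥ (suc n) p (suc k) (s≤s n≤k) =
  trans (coeff-≡ (0∷-⊗ (x^ n) p) (suc k)) (coeff-x^-⊗-≥ n p k n≤k)

linear : ℤ → ℤ → Poly
linear a b = a ∷ b ∷ []

linear-⊗-linear : ∀ a b c d → linear a b ⊗ linear c d ≈ a * c ∷ a * d + b * c ∷ b * d ∷ []
linear-⊗-linear a b c d =
  ∷-cong (ℤP.+-identityʳ (a * c)) (∷-cong (cong (λ x → a * d + x) (ℤP.+-identityʳ (b * c))) ≈-refl)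

linear-⊗ : ∀ a b p → linear a b ⊗ p ≈ (a · p) ⊕ (+ 0 ∷ (b · p))
linear-⊗ a b p = ⊕-cong (≈-refl {a · p})
  (∷-cong refl (≈-trans (⊕-cong (≈-refl {b · p}) 0∷[]≈[]) (≈-reflexive (⊕-identityʳ (b · p)))))

coeff-linear-⊗-zero : ∀ a b p → coeff (linear a b ⊗ p) 0 ≡ a * coeff p 0
coeff-linear-⊗-zero a b p = begin
  coeff (linear a b ⊗ p) 0             ≡⟨ coeff-≡ (linear-⊗ a b p) 0 ⟩
  coeff ((a · p) ⊕ (+ 0 ∷ (b · p))) 0  ≡⟨ coeff-⊕ (a · p) (+ 0 ∷ (b · p)) 0 ⟩
  coeff (a · p) 0 + + 0                ≡⟨ ℤP.+-identityʳ (coeff (a · p) 0) ⟩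
  coeff (a · p) 0                      ≡⟨ coeff-· a p 0 ⟩
  a * coeff p 0                        ∎
  where open ≡-Reasoning

coeff-linear-⊗-suc : ∀ a b p k → coeff (linear a b ⊗ p) (suc k) ≡ a * coeff p (suc k) + b * coeff p k
coeff-linear-⊗-suc a b p k = begin
  coeff (linear a b ⊗ p) (suc k)             ≡⟨ coeff-≡ (linear-⊗ a b p) (suc k) ⟩
  coeff ((a · p) ⊕ (+ 0 ∷ (b · p))) (suc k)  ≡⟨ coeff-⊕ (a · p) (+ 0 ∷ (b · p)) (suc k) ⟩
  coeff (a · p) (suc k) + coeff (b · p) k    ≡⟨ cong₂ _+_ (coeff-· a p (suc k)) (coeff-· b p k) ⟩
  a * coeff p (suc k) + b * coeff p k        ∎
  where open ≡-Reasoning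

descent : ∀ {m} c H T → linear c (+ 1) ⊗ H ≈ T mod m →
          ∀ k → coeff H k ≡ coeff T (suc k) - c * coeff H (suc k) mod m
descent {m} c H T e k = begin
  coeff H k                                                      ≡⟨ isolate (coeff H k) (coeff H (suc k)) c ⟩
  (c * coeff H (suc k) + + 1 * coeff H k) - c * coeff H (suc k)
    ≡⟨ cong (λ x → x - c * coeff H (suc k)) (coeff-linear-⊗-suc c (+ 1) H k) ⟨
  coeff (linear c (+ 1) ⊗ H) (suc k) - c * coeff H (suc k)
    ≈⟨ +-congʳ-mod (- (c * coeff H (suc k))) (coeff-mod e (suc k)) ⟩
  coeff T (suc k) - c * coeff H (suc k)                          ∎
  where
  open ℤ-mod-Reasoning m
  isolate : ∀ h h′ c → h ≡ (c * h′ + + 1 * h) - c * h′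
  isolate = solve-∀

ascent-zero : ∀ c R → coeff R 0 ≡ coeff (linear (+ 1) c ⊗ R) 0
ascent-zero c R = sym (trans (coeff-linear-⊗-zero (+ 1) c R) (ℤP.*-identityˡ (coeff R 0)))

ascent-suc : ∀ c R k → coeff R (suc k) ≡ coeff (linear (+ 1) c ⊗ R) (suc k) - c * coeff R k
ascent-suc c R k = trans (isolate (coeff R (suc k)) (coeff R k) c)
  (cong (λ x → x - c * coeff R k) (sym (coeff-linear-⊗-suc (+ 1) c R k)))
  where
  isolate : ∀ r r′ c → r ≡ (+ 1 * r + c * r′) - c * r′
  isolate = solve-∀

-- Beyond its length p vanishes exactly, and the recurrence carries this down to K.
recurrence-vanishes : ∀ {m} c p K → (∀ k → K ≤ k → coeff p k ≡ c * coeff p (suc k) mod m) →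
                      ∀ k → K ≤ k → coeff p k ≡ + 0 mod m
recurrence-vanishes {m} c p K rec k K≤k = from-length (length p) k (ℕP.m≤n+m (length p) k) K≤k
  where
  from-length : ∀ d k → length p ≤ k ℕ.+ d → K ≤ k → coeff p k ≡ + 0 mod m
  from-length zero k len≤k _ =
    mod-reflexive (coeff-beyond-length p k (subst (length p ≤_) (ℕP.+-identityʳ k) len≤k))
  from-length (suc d) k len≤ K≤k = begin
    coeff p k            ≈⟨ rec k K≤k ⟩
    c * coeff p (suc k)  ≈⟨ *-congˡ-mod c next-vanishes ⟩
    c * + 0              ≡⟨ ℤP.*-zeroʳ c ⟩
    + 0                  ∎
    where
    open ℤ-mod-Reasoning m
    next-vanishes : coeff p (suc k) ≡ + 0 mod m
    next-vanishes = from-length d (suc k) (subst (length p ≤_) (ℕP.+-suc k d) len≤) (ℕP.m≤n⇒m≤1+n K≤k)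

∏ : ℕ → (ℕ → Poly) → Poly
∏ zero f = one
∏ (suc L) f = f 0 ⊗ ∏ L (λ i → f (suc i))

foldr-applyUpTo : ∀ (f : ℕ → Poly) (h : ℕ → ℕ) L →
                  foldr (λ j acc → f j ⊗ acc) one (applyUpTo h L) ≡ ∏ L (λ i → f (h i))
foldr-applyUpTo f h zero = refl
foldr-applyUpTo f h (suc L) = cong (f (h 0) ⊗_) (foldr-applyUpTo f (λ i → h (suc i)) L)

∏-+ : ∀ a b f → ∏ (a ℕ.+ b) f ≈ ∏ a f ⊗ ∏ b (λ i → f (a ℕ.+ i))
∏-+ zero b f = ≈-sym (⊗-identityˡ (∏ b f))
∏-+ (suc a) b f = begin
  f 0 ⊗ ∏ (a ℕ.+ b) g                      ≈⟨ ⊗-cong (≈-refl {f 0}) (∏-+ a b g) ⟩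
  f 0 ⊗ (∏ a g ⊗ ∏ b (λ i → g (a ℕ.+ i)))  ≈⟨ ⊗-assoc (f 0) (∏ a g) _ ⟨
  (f 0 ⊗ ∏ a g) ⊗ ∏ b (λ i → g (a ℕ.+ i))  ∎
  where
  open ≈-Reasoning
  g : ℕ → Poly
  g i = f (suc i)

∏-cong-mod : ∀ {m} L {f g} → (∀ i → i < L → f i ≈ g i mod m) → ∏ L f ≈ ∏ L g mod m
∏-cong-mod zero e = ≈-mod-refl
∏-cong-mod (suc L) e = ⊗-cong-mod (e 0 (s≤s z≤n)) (∏-cong-mod L λ i i<L → e (suc i) (s≤s i<L))

∏-cong : ∀ L {f g} → (∀ i → i < L → f i ≈ g i) → ∏ L f ≈ ∏ L g
∏-cong L e = ≈-mod-0⇒≈ (∏-cong-mod L λ i i<L → ≈⇒≈-mod (e i i<L))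

-- Blocks of consecutive linear factors

factor : ℤ → ℤ → ℕ → Poly
factor u w i = linear (u - + i) (w + + i)

block : ℕ → ℤ → ℤ → Poly
block L u w = ∏ L (factor u w)

block-+ : ∀ a b u w → block (a ℕ.+ b) u w ≈ block a u w ⊗ block b (u - + a) (w + + a)
block-+ a b u w = ≈-trans (∏-+ a b (factor u w)) (⊗-cong (≈-refl {block a u w}) (∏-cong b λ i _ →
  ≈-reflexive (cong₂ linear (regroup u (+ a) (+ i)) (sym (ℤP.+-assoc w (+ a) (+ i))))))
  where
  regroup : ∀ u a i → u - (a + i) ≡ (u - a) - i
  regroup = solve-∀

block-cong-mod : ∀ {m u u′ w w′} L → u ≡ u′ mod m → w ≡ w′ mod m →
                 block L u w ≈ block L u′ w′ mod m
block-cong-mod L u≡u′ w≡w′ = ∏-cong-mod L λ i _ →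
  ∷-cong-mod (+-congʳ-mod (- + i) u≡u′) (∷-cong-mod (+-congʳ-mod (+ i) w≡w′) ≈-mod-refl)

block-double : ∀ N u w → block (2 ℕ.* N) u w ≈ block N u w ⊗ block N u w mod N
block-double N u w = begin
  block (2 ℕ.* N) u w                        ≡⟨ cong (λ L → block (N ℕ.+ L) u w) (ℕP.+-identityʳ N) ⟩
  block (N ℕ.+ N) u w                        ≈⟨ ≈⇒≈-mod (block-+ N N u w) ⟩
  block N u w ⊗ block N (u - + N) (w + + N)
    ≈⟨ ⊗-congʳ-mod (block N u w) (block-cong-mod N u-N≡u w+N≡w) ⟩
  block N u w ⊗ block N u w                  ∎
  where
  open ≈-mod-Reasoning N
  u-N≡u : u - + N ≡ u mod N
  u-N≡u = mod-by-multiple (- + 1) (cancel u (+ N))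
    where
    cancel : ∀ u n → (u - n) - u ≡ (- + 1) * n
    cancel = solve-∀
  w+N≡w : w + + N ≡ w mod N
  w+N≡w = mod-by-multiple (+ 1) (cancel w (+ N))
    where
    cancel : ∀ w n → (w + n) - w ≡ + 1 * n
    cancel = solve-∀

block-two-odd : ∀ u w → u + w ≡ + 1 mod 2 → block 2 u w ≈ x^ 1 mod 2
block-two-odd u w odd = begin
  factor u w 0 ⊗ (factor u w 1 ⊗ one)
    ≈⟨ ≈⇒≈-mod (⊗-cong (≈-refl {factor u w 0}) (⊗-identityʳ (factor u w 1))) ⟩
  factor u w 0 ⊗ factor u w 1
    ≈⟨ ≈⇒≈-mod (linear-⊗-linear (u - + 0) (w + + 0) (u - + 1) (w + + 1)) ⟩
  (u - + 0) * (u - + 1) ∷ (u - + 0) * (w + + 1) + (w + + 0) * (u - + 1) ∷ (w + + 0) * (w + + 1) ∷ []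
    ≈⟨ ∷-cong-mod constant (∷-cong-mod linear-term (∷-cong-mod quadratic ≈-mod-refl)) ⟩
  + 0 ∷ + 1 ∷ + 0 ∷ []                 ≈⟨ ≈⇒≈-mod (∷-cong refl (∷-cong refl 0∷[]≈[])) ⟩
  x^ 1                                 ∎
  where
  open ≈-mod-Reasoning 2
  shift-down : ∀ u → (u - + 0) * (u - + 1) ≡ (u - + 1) * ((u - + 1) + + 1)
  shift-down = solve-∀
  drop-zero : ∀ w → (w + + 0) * (w + + 1) ≡ w * (w + + 1)
  drop-zero = solve-∀
  parity : ∀ u w → ((u - + 0) * (w + + 1) + (w + + 0) * (u - + 1)) - (u + w) ≡ (u * w - w) * + 2
  parity = solve-∀
  constant : (u - + 0) * (u - + 1) ≡ + 0 mod 2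
  constant = mod-trans (mod-reflexive (shift-down u)) (consecutive-even (u - + 1))
  quadratic : (w + + 0) * (w + + 1) ≡ + 0 mod 2
  quadratic = mod-trans (mod-reflexive (drop-zero w)) (consecutive-even w)
  linear-term : (u - + 0) * (w + + 1) + (w + + 0) * (u - + 1) ≡ + 1 mod 2
  linear-term = mod-trans (mod-by-multiple (u * w - w) (parity u w)) odd

BlockProperty : ℕ → Set
BlockProperty N = ∀ u w → u + w ≡ + 1 mod 2 → block (2 ℕ.* N) u w ≈ x^ N mod N

block-property : ∀ q → BlockProperty (2 ^ suc q)
block-property zero u w odd = begin
  block 4 u w                ≈⟨ block-double 2 u w ⟩
  block 2 u w ⊗ block 2 u w  ≈⟨ ⊗-cong-mod (block-two-odd u w odd) (block-two-odd u w odd) ⟩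
  x^ 1 ⊗ x^ 1                ≈⟨ ≈⇒≈-mod (x^-+ 1 1) ⟨
  x^ 2                       ∎
  where open ≈-mod-Reasoning 2
block-property (suc q) u w odd = begin
  block (2 ℕ.* N) u w        ≈⟨ block-double N u w ⟩
  block N u w ⊗ block N u w  ≈⟨ square-mod {k = 2 ^ q} (block-property q u w odd) ⟩
  x^ M ⊗ x^ M                ≈⟨ ≈⇒≈-mod (x^-+ M M) ⟨
  x^ (M ℕ.+ M)               ≡⟨ cong (λ L → x^ (M ℕ.+ L)) (ℕP.+-identityʳ M) ⟨
  x^ N                       ∎
  where
  open ≈-mod-Reasoning (2 ^ suc (suc q))
  M N : ℕ
  M = 2 ^ suc q
  N = 2 ^ suc (suc q)

-- Periodicity of v

P-block : ℕ → Poly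
P-block n = block (2 ℕ.* n) (+ (2 ℕ.* n) - + 1) (+ 0)

P-suc≈P-block : ∀ n → P (suc n) ≈ P-block n
P-suc≈P-block zero = ≈-refl
P-suc≈P-block (suc k) = begin
  foldr (λ j acc → F j ⊗ acc) one (applyUpTo id (suc M))  ≡⟨ foldr-applyUpTo F id (suc M) ⟩
  ∏ (suc M) F                                             ≈⟨ ∏-cong (suc M) F≈factor ⟩
  block (suc M) u (+ 0)                                   ≡⟨ cong (λ L → block L u (+ 0)) (ℕP.*-suc 2 k) ⟨
  P-block (suc k)                                         ∎
  where
  open ≈-Reasoning
  M : ℕ
  M = suc (2 ℕ.* k)
  u : ℤ
  u = + (2 ℕ.* suc k) - + 1
  F : ℕ → Poly
  F j = + (M ∸ j) ∷ + j ∷ []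
  F≈factor : ∀ i → i < suc M → F i ≈ factor u (+ 0) i
  F≈factor i (s≤s i≤M) = ≈-reflexive (cong (λ a → linear a (+ i))
    (trans (pos-∸ i≤M) (cong (λ L → + L - + 1 - + i) (sym (ℕP.*-suc 2 k)))))

v-suc≡ : ∀ n → v (suc n) ≡ coeff (oneMinusX ⊗ P-block n) n
v-suc≡ n = coeff-≡ (⊗-cong (≈-refl {oneMinusX}) (P-suc≈P-block n)) n

odd-2n-1 : ∀ n → + (2 ℕ.* n) - + 1 ≡ + 1 mod 2
odd-2n-1 n = mod-by-multiple (+ n - + 1) (trans (cong (λ x → x - + 1 - + 1) (ℤP.pos-* 2 n)) (halve (+ n)))
  where
  halve : ∀ n → + 2 * n - + 1 - + 1 ≡ (n - + 1) * + 2
  halve = solve-∀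

2[N+n]-1≡2n-1 : ∀ N n → + (2 ℕ.* (N ℕ.+ n)) - + 1 ≡ + (2 ℕ.* n) - + 1 mod N
2[N+n]-1≡2n-1 N n = mod-by-multiple (+ 2)
  (trans (cong₂ (λ x y → (x - + 1) - (y - + 1)) (ℤP.pos-* 2 (N ℕ.+ n)) (ℤP.pos-* 2 n))
         (difference (+ N) (+ n)))
  where
  difference : ∀ N n → (+ 2 * (N + n) - + 1) - (+ 2 * n - + 1) ≡ + 2 * N
  difference = solve-∀

P-block-shift : ∀ {N} → BlockProperty N → ∀ n → P-block (N ℕ.+ n) ≈ P-block n ⊗ x^ N mod N
P-block-shift {N} blockN n = begin
  block (2 ℕ.* (N ℕ.+ n)) u (+ 0)                ≡⟨ cong (λ L → block L u (+ 0)) (split N n) ⟩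
  block (2 ℕ.* n ℕ.+ 2 ℕ.* N) u (+ 0)
    ≈⟨ ≈⇒≈-mod (block-+ (2 ℕ.* n) (2 ℕ.* N) u (+ 0)) ⟩
  block (2 ℕ.* n) u (+ 0) ⊗ block (2 ℕ.* N) (u - + (2 ℕ.* n)) (+ (2 ℕ.* n))
    ≈⟨ ⊗-cong-mod (block-cong-mod {w = + 0} (2 ℕ.* n) (2[N+n]-1≡2n-1 N n) mod-refl)
                   (blockN (u - + (2 ℕ.* n)) (+ (2 ℕ.* n)) odd) ⟩
  P-block n ⊗ x^ N                               ∎
  where
  open ≈-mod-Reasoning N
  u : ℤ
  u = + (2 ℕ.* (N ℕ.+ n)) - + 1
  split : ∀ N n → 2 ℕ.* (N ℕ.+ n) ≡ 2 ℕ.* n ℕ.+ 2 ℕ.* N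
  split = ℕ-Solver.solve-∀
  cancel : ∀ u a → (u - a) + a ≡ u
  cancel = solve-∀
  odd : (u - + (2 ℕ.* n)) + + (2 ℕ.* n) ≡ + 1 mod 2
  odd = mod-trans (mod-reflexive (cancel u (+ (2 ℕ.* n)))) (odd-2n-1 (N ℕ.+ n))

v-shift-suc : ∀ {N} → BlockProperty N → ∀ n → v (N ℕ.+ suc n) ≡ v (suc n) mod N
v-shift-suc {N} blockN n = begin
  v (N ℕ.+ suc n)                                   ≡⟨ cong v (ℕP.+-suc N n) ⟩
  v (suc (N ℕ.+ n))                                 ≡⟨ v-suc≡ (N ℕ.+ n) ⟩
  coeff (oneMinusX ⊗ P-block (N ℕ.+ n)) (N ℕ.+ n)
    ≈⟨ coeff-mod (⊗-congʳ-mod oneMinusX (P-block-shift blockN n)) (N ℕ.+ n) ⟩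
  coeff (oneMinusX ⊗ (P-block n ⊗ x^ N)) (N ℕ.+ n)  ≡⟨ coeff-≡ rearrange (N ℕ.+ n) ⟩
  coeff (x^ N ⊗ R) (N ℕ.+ n)                        ≡⟨ coeff-x^-⊗-≥ N R (N ℕ.+ n) (ℕP.m≤m+n N n) ⟩
  coeff R (N ℕ.+ n ∸ N)                             ≡⟨ cong (coeff R) (ℕP.m+n∸m≡n N n) ⟩
  coeff R n                                         ≡⟨ v-suc≡ n ⟨
  v (suc n)                                         ∎
  where
  open ℤ-mod-Reasoning N
  R : Poly
  R = oneMinusX ⊗ P-block n
  rearrange : oneMinusX ⊗ (P-block n ⊗ x^ N) ≈ x^ N ⊗ R
  rearrange = ≈-trans (≈-sym (⊗-assoc oneMinusX (P-block n) (x^ N))) (⊗-comm R (x^ N))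

-- With S = (1 + 2x)(2 + x) and N = n + 1, the block property gives P-block n ⊗ S ≡ x^N.  For
-- R = (1 − x) P-block n and H = (1 + 2x) R this reads (2 + x) H ≡ x^N (1 − x): it determines the
-- coefficients of H from the top down, as H is a polynomial, and then those of R from the bottom up.
module MiddleCoefficient {n : ℕ} (blockN : BlockProperty (suc n)) where

  N : ℕ
  N = suc n

  u : ℤ
  u = + (2 ℕ.* n) - + 1

  S R H : Poly
  S = linear (+ 1) (+ 2) ⊗ linear (+ 2) (+ 1)
  R = oneMinusX ⊗ P-block n
  H = linear (+ 1) (+ 2) ⊗ R

  t : ℕ → ℤ
  t = coeff (x^ N ⊗ oneMinusX)

  P-block⊗S : P-block n ⊗ S ≈ x^ N mod N
  P-block⊗S = begin
    P-block n ⊗ S                                        ≡⟨⟩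
    P-block n ⊗ block 2 (- + 1) (- + 2)
      ≈⟨ ⊗-congʳ-mod (P-block n) (block-cong-mod 2 u-2n≡-1 2n≡-2) ⟨
    P-block n ⊗ block 2 (u - + (2 ℕ.* n)) (+ (2 ℕ.* n))  ≈⟨ ≈⇒≈-mod (block-+ (2 ℕ.* n) 2 u (+ 0)) ⟨
    block (2 ℕ.* n ℕ.+ 2) u (+ 0)                        ≡⟨ cong (λ L → block L u (+ 0)) (length-eq n) ⟩
    block (2 ℕ.* N) u (+ 0)                              ≈⟨ blockN u (+ 0) odd ⟩
    x^ N                                                 ∎
    where
    open ≈-mod-Reasoning N
    length-eq : ∀ n → 2 ℕ.* n ℕ.+ 2 ≡ 2 ℕ.* suc n
    length-eq = ℕ-Solver.solve-∀
    cancel : ∀ x → (x - + 1) - x ≡ - + 1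
    cancel = solve-∀
    u-2n≡-1 : u - + (2 ℕ.* n) ≡ - + 1 mod N
    u-2n≡-1 = mod-reflexive (cancel (+ (2 ℕ.* n)))
    complete : ∀ n → + 2 * n - - + 2 ≡ + 2 * (+ 1 + n)
    complete = solve-∀
    2n≡-2 : + (2 ℕ.* n) ≡ - + 2 mod N
    2n≡-2 = mod-by-multiple (+ 2) (trans (cong (λ x → x - - + 2) (ℤP.pos-* 2 n)) (complete (+ n)))
    odd : u + + 0 ≡ + 1 mod 2
    odd = mod-trans (mod-reflexive (ℤP.+-identityʳ u)) (odd-2n-1 n)

  H-reassociated : linear (+ 2) (+ 1) ⊗ H ≈ oneMinusX ⊗ (P-block n ⊗ S)
  H-reassociated = begin
    a ⊗ (b ⊗ R)                        ≈⟨ ⊗-assoc a b R ⟨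
    (a ⊗ b) ⊗ R                        ≈⟨ ⊗-cong (⊗-comm a b) (≈-refl {R}) ⟩
    (b ⊗ a) ⊗ R                        ≈⟨ ⊗-comm (b ⊗ a) R ⟩
    R ⊗ (b ⊗ a)                        ≈⟨ ⊗-assoc oneMinusX (P-block n) (b ⊗ a) ⟩
    oneMinusX ⊗ (P-block n ⊗ (b ⊗ a))  ∎
    where
    open ≈-Reasoning
    a b : Poly
    a = linear (+ 2) (+ 1)
    b = linear (+ 1) (+ 2)

  H-recurrence : linear (+ 2) (+ 1) ⊗ H ≈ x^ N ⊗ oneMinusX mod N
  H-recurrence = begin
    linear (+ 2) (+ 1) ⊗ H        ≈⟨ ≈⇒≈-mod H-reassociated ⟩
    oneMinusX ⊗ (P-block n ⊗ S)   ≈⟨ ⊗-congʳ-mod oneMinusX P-block⊗S ⟩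
    oneMinusX ⊗ x^ N              ≈⟨ ≈⇒≈-mod (⊗-comm oneMinusX (x^ N)) ⟩
    x^ N ⊗ oneMinusX              ∎
    where open ≈-mod-Reasoning N

  H-step : ∀ k → coeff H k ≡ t (suc k) - + 2 * coeff H (suc k) mod N
  H-step = descent (+ 2) H (x^ N ⊗ oneMinusX) H-recurrence

  t-below : ∀ k → k < N → t k ≡ + 0
  t-below = coeff-x^-⊗-< N oneMinusX

  t-N : t N ≡ + 1
  t-N = trans (coeff-x^-⊗-≥ N oneMinusX N ℕP.≤-refl) (cong (coeff oneMinusX) (ℕP.n∸n≡0 N))

  t-suc-N : t (suc N) ≡ - + 1
  t-suc-N = trans (coeff-x^-⊗-≥ N oneMinusX (suc N) (ℕP.n≤1+n N))
                  (cong (coeff oneMinusX) (ℕP.m+n∸n≡m 1 N))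

  t-above : ∀ k → 2 ℕ.+ N ≤ k → t k ≡ + 0
  t-above k le = trans (coeff-x^-⊗-≥ N oneMinusX k (ℕP.m+n≤o⇒n≤o 2 le))
                       (coeff-beyond-length oneMinusX (k ∸ N) (ℕP.m+n≤o⇒m≤o∸n 2 le))

  H-step-by : ∀ {k a b} → t (suc k) ≡ a → coeff H (suc k) ≡ b mod N → coeff H k ≡ a - + 2 * b mod N
  H-step-by {k} t≡a H≡b =
    mod-trans (H-step k) (+-cong-mod (mod-reflexive t≡a) (-‿cong-mod (*-congˡ-mod (+ 2) H≡b)))

  H-above : ∀ k → suc N ≤ k → coeff H k ≡ + 0 mod N
  H-above = recurrence-vanishes (- + 2) H (suc N) λ k le → begin
    coeff H k                     ≈⟨ H-step-by (t-above (suc k) (s≤s le)) mod-refl ⟩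
    + 0 - + 2 * coeff H (suc k)   ≡⟨ negate (coeff H (suc k)) ⟩
    - + 2 * coeff H (suc k)       ∎
    where
    open ℤ-mod-Reasoning N
    negate : ∀ x → + 0 - + 2 * x ≡ - + 2 * x
    negate = solve-∀

  H-top : coeff H N ≡ - + 1 mod N
  H-top = H-step-by t-suc-N (H-above (suc N) ℕP.≤-refl)

  H-at-n : coeff H n ≡ + 3 mod N
  H-at-n = H-step-by t-N H-top

  H-below : ∀ i k → k ℕ.+ i ≡ n → coeff H k ≡ + 3 * (- + 2) ℤ.^ i mod N
  H-below zero k k+0≡n =
    subst (λ j → coeff H j ≡ + 3 mod N) (sym (trans (sym (ℕP.+-identityʳ k)) k+0≡n)) H-at-n
  H-below (suc i) k k+1+i≡n = begin
    coeff H k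
      ≈⟨ H-step-by (t-below (suc k) (s≤s suc-k≤n)) (H-below i (suc k) suc-k+i≡n) ⟩
    + 0 - + 2 * (+ 3 * (- + 2) ℤ.^ i)   ≡⟨ regroup ((- + 2) ℤ.^ i) ⟩
    + 3 * (- + 2) ℤ.^ suc i             ∎
    where
    open ℤ-mod-Reasoning N
    suc-k+i≡n : suc k ℕ.+ i ≡ n
    suc-k+i≡n = trans (sym (ℕP.+-suc k i)) k+1+i≡n
    suc-k≤n : suc k ≤ n
    suc-k≤n = subst (suc k ≤_) suc-k+i≡n (ℕP.m≤m+n (suc k) i)
    regroup : ∀ a → + 0 - + 2 * (+ 3 * a) ≡ + 3 * (- + 2 * a)
    regroup = solve-∀

  R-below : ∀ k e → k ℕ.+ e ≡ n → coeff R k ≡ (- + 2) ℤ.^ e * ((+ 4) ℤ.^ suc k - + 1) mod N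
  R-below zero e e≡n = begin
    coeff R 0                      ≡⟨ ascent-zero (+ 2) R ⟩
    coeff H 0                      ≈⟨ H-below e 0 e≡n ⟩
    + 3 * (- + 2) ℤ.^ e            ≡⟨ regroup ((- + 2) ℤ.^ e) ⟩
    (- + 2) ℤ.^ e * (+ 4 - + 1)    ∎
    where
    open ℤ-mod-Reasoning N
    regroup : ∀ a → + 3 * a ≡ a * (+ 4 - + 1)
    regroup = solve-∀
  R-below (suc k) e k+1+e≡n = begin
    coeff R (suc k)                             ≡⟨ ascent-suc (+ 2) R k ⟩
    coeff H (suc k) - + 2 * coeff R k
      ≈⟨ +-cong-mod (H-below e (suc k) k+1+e≡n) (-‿cong-mod (*-congˡ-mod (+ 2) R-at-k)) ⟩
    + 3 * a - + 2 * ((- + 2 * a) * (b - + 1))   ≡⟨ regroup a b ⟩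
    a * (+ 4 * b - + 1)                         ∎
    where
    open ℤ-mod-Reasoning N
    a b : ℤ
    a = (- + 2) ℤ.^ e
    b = (+ 4) ℤ.^ suc k
    R-at-k : coeff R k ≡ (- + 2 * a) * (b - + 1) mod N
    R-at-k = R-below k (suc e) (trans (ℕP.+-suc k e) k+1+e≡n)
    regroup : ∀ a b → + 3 * a - + 2 * ((- + 2 * a) * (b - + 1)) ≡ a * (+ 4 * b - + 1)
    regroup = solve-∀

v-shift-zero : ∀ {N} → BlockProperty N → (+ 4) ℤ.^ N ≡ + 0 mod N → v N ≡ v 0 mod N
v-shift-zero {zero} _ _ = mod-refl
v-shift-zero {suc n} blockN 4^N≡0 = begin
  v (suc n)                               ≡⟨ v-suc≡ n ⟩
  coeff R n                               ≈⟨ R-below n 0 (ℕP.+-identityʳ n) ⟩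
  + 1 * ((+ 4) ℤ.^ suc n - + 1)           ≈⟨ *-congˡ-mod (+ 1) (+-congʳ-mod (- + 1) 4^N≡0) ⟩
  + 1 * (+ 0 - + 1)                       ∎
  where
  open ℤ-mod-Reasoning (suc n)
  open MiddleCoefficient blockN

v-shift : ∀ q m → v (2 ^ suc q ℕ.+ m) ≡ v m mod 2 ^ suc q
v-shift q zero = subst (λ j → v j ≡ v 0 mod 2 ^ suc q) (sym (ℕP.+-identityʳ (2 ^ suc q)))
                   (v-shift-zero (block-property q) (4^2^q≡0 (suc q)))
v-shift q (suc m) = v-shift-suc (block-property q) m

v-periodic : ∀ q k i → v (k ℕ.* 2 ^ suc q ℕ.+ i) ≡ v i mod 2 ^ suc q
v-periodic q zero i = mod-refl
v-periodic q (suc k) i = mod-trans one-period (v-periodic q k i)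
  where
  N : ℕ
  N = 2 ^ suc q
  one-period : v (N ℕ.+ k ℕ.* N ℕ.+ i) ≡ v (k ℕ.* N ℕ.+ i) mod N
  one-period = subst (λ j → v j ≡ v (k ℕ.* N ℕ.+ i) mod N) (sym (ℕP.+-assoc N (k ℕ.* N) i))
                     (v-shift q (k ℕ.* N ℕ.+ i))

mainTheorem15 : (q : ℕ) → q ≥ 1 → (i k : ℕ) →
    (+ (2 ^ q)) ∣ (v (k ℕ.* 2 ^ q ℕ.+ i) - v i)
mainTheorem15 zero () i k
mainTheorem15 (suc q) _ i k = Signed.∣⇒∣ᵤ (difference-divisible (v-periodic q k i))
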